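{- Let $a$ be a single numerical attribute with finite totally ordered domain $Dom(a)$. Patterns are intervals $\langle \alpha_i \le a \le \alpha_j\rangle$ with $\alpha_i\le\alpha_j$ in $Dom(a)$; a pattern is more specific than another ($s'\preceq s$) iff its interval is contained in the other's. Direct refinements of an interval are a left change (replace the lower bound by the next larger value of $Dom(a)$) and a right change (replace the upper bound by the next smaller value of $Dom(a)$). In the lectic enumeration tree, a node obtained by a left change may be refined by both left and right changes, while a node obtained by a right change may only be refined by right changes. For a pattern $s'=\langle \alpha_i\le a\le\alpha_j\rangle$ let $n$ be the number of values of $Dom(a)$ in $[\alpha_i,\alpha_j]$, let $V_{total}(s')$ be the number of patterns $s''\preceq s'$ (i.e. the number of sub-intervals with endpoints in $Dom(a)\cap[\alpha_i,\alpha_j]$), let $V_{lectic}(s')$ be the number of patterns in the subtree of the lectic enumeration tree rooted at $s'$, and let $\rho_{norm}(s')=V_{total}(s')/V_{lectic}(s')$. Then: if $s'$ was obtained by a left change, $\rho_{norm}(s')=1$; if $s'$ was obtained by a right change, $\rho_{norm}(s')=\frac{n+1}{2}$.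
   Context: This concerns the enumeration of interval patterns on a numerical attribute in a Monte Carlo tree search for pattern mining. The lectic enumeration is a depth-first enumeration in which each interval is generated exactly once, obtained by ordering left changes before right changes. The normalized exploration rate of a pattern is the ratio between the number of its specializations in the pattern lattice (including itself) and the number of patterns in its subtree of the lectic enumeration tree. -}

module Defs where

open import Data.Nat using (NonZero; ℕ; zero; suc; _+_; _*_; _∸_; _≤_; _<_)
open import Data.Product using (_×_; _,_; Σ; ∃)
open import Data.List using (List; []; _∷_; map; upTo; length; concatMap)
open import Data.Integer using (+_)
open import Data.Rational using (ℚ; _/_)
open import Relation.Binary.PropositionalEquality using (_≡_)

-- The finite totally ordered domain Dom(a) of size m is identified with
-- {0, 1, ..., m-1} (order-isomorphic); values are their ranks.
-- A pattern <α_i ≤ a ≤ α_j> is represented by the pair of ranks (i , j)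
-- with i ≤ j < m.

valuesIn : ℕ → ℕ → List ℕ
valuesIn i j = map (λ d → i + d) (upTo (suc (j ∸ i)))

nVals : ℕ → ℕ → ℕ
nVals i j = length (valuesIn i j)

subIntervals : ℕ → ℕ → List (ℕ × ℕ)
subIntervals i j = concatMap (λ k → map (λ l → (k , l)) (valuesIn k j)) (valuesIn i j)

Vtotal : ℕ → ℕ → ℕ
Vtotal i j = length (subIntervals i j)

data Change : Set where
  leftChange rightChange : Change

data Tree : Set where
  node : ℕ × ℕ → List Tree → Tree

mutual
  size : Tree → ℕ
  size (node _ ts) = suc (sizes ts)

  sizes : List Tree → ℕ
  sizes [] = zero
  sizes (t ∷ ts) = size t + sizes ts

size-nonZero : (t : Tree) → NonZero (size t)
size-nonZero (node _ ts) = _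

lecticTree : Change → (i w : ℕ) → Tree
lecticTree c i zero = node (i , i) []
lecticTree leftChange i (suc w) =
  node (i , i + suc w) (lecticTree leftChange (suc i) w ∷ lecticTree rightChange i w ∷ [])
lecticTree rightChange i (suc w) =
  node (i , i + suc w) (lecticTree rightChange i w ∷ [])

Vlectic : Change → ℕ → ℕ → ℕ
Vlectic c i j = size (lecticTree c i (j ∸ i))

ρnorm : Change → ℕ → ℕ → ℚ
ρnorm c i j = _/_ (+ Vtotal i j) (Vlectic c i j) {{size-nonZero (lecticTree c i (j ∸ i))}}

-- (i , j) in a domain of size m was obtained from a valid parent pattern by the given change
ObtainedBy : Change → (m i j : ℕ) → Set
ObtainedBy leftChange m i j = Σ ℕ (λ i' → suc i' ≡ i)
ObtainedBy rightChange m i j = Σ ℕ (λ j' → (j' ≡ suc j) × (j' < m))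

-- A chain of n values has triangle n = n + (n-1) + ... + 1 sub-intervals, and so does the
-- lectic subtree below a left change: such a node has a left child (the same chain minus its
-- lowest value, again a left-change node) and a right child whose subtree is a path of n - 1
-- nodes, giving the recursion triangle n = triangle (n-1) + n. Below a right change the subtree
-- is a path with n nodes; since 2 · triangle n = n (n + 1), the two rates are 1 and
-- (n + 1) / 2.
module Submission where

open import Defs
open import Data.Nat using (ℕ; zero; suc; _+_; _*_; _∸_; _≤_; _<_; NonZero)
open import Data.Nat.Properties using (+-identityʳ; +-comm; *-comm; *-distribʳ-+; *-distribˡ-+; ∸-+-assoc)
open import Data.Nat.ListAction using (sum)
open import Data.Product using (_×_; _,_)
open import Data.List using (List; []; _∷_; map; upTo; applyUpTo; length; concatMap)
open import Data.List.Properties using (length-++; length-map; length-upTo; map-∘; map-cong; map-applyUpTo)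
open import Data.Integer using (+_)
open import Data.Integer.Properties using (pos-*)
open import Data.Rational using (_/_; 1ℚ)
open import Data.Rational.Properties using (/-cong; fromℚᵘ-cong)
open import Data.Rational.Unnormalised using (mkℚᵘ; *≡*)
open import Function using (_∘_; id)
open import Relation.Binary.PropositionalEquality using (_≡_; refl; sym; trans; cong; cong₂; module ≡-Reasoning)

open ≡-Reasoning

triangle : ℕ → ℕ
triangle zero    = zero
triangle (suc n) = suc n + triangle n

triangle-*2 : ∀ n → triangle n * 2 ≡ n * suc n
triangle-*2 zero    = refl
triangle-*2 (suc n) = begin
  (suc n + triangle n) * 2     ≡⟨ *-distribʳ-+ 2 (suc n) (triangle n) ⟩
  suc n * 2 + triangle n * 2   ≡⟨ cong (_+_ (suc n * 2)) (triangle-*2 n) ⟩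
  suc n * 2 + n * suc n        ≡⟨ cong (_+_ (suc n * 2)) (*-comm n (suc n)) ⟩
  suc n * 2 + suc n * n        ≡⟨ *-distribˡ-+ (suc n) 2 n ⟨
  suc n * suc (suc n)          ∎

sum-applyUpTo-suc∸ : ∀ w → sum (applyUpTo (λ d → suc (w ∸ d)) (suc w)) ≡ triangle (suc w)
sum-applyUpTo-suc∸ zero    = refl
sum-applyUpTo-suc∸ (suc w) = cong (_+_ (suc (suc w))) (sum-applyUpTo-suc∸ w)

length-concatMap : ∀ {A B : Set} (f : A → List B) xs →
                   length (concatMap f xs) ≡ sum (map (length ∘ f) xs)
length-concatMap f []       = refl
length-concatMap f (x ∷ xs) =
  trans (length-++ (f x)) (cong (_+_ (length (f x))) (length-concatMap f xs))

nVals≡ : ∀ i j → nVals i j ≡ suc (j ∸ i)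
nVals≡ i j = trans (length-map (_+_ i) (upTo (suc (j ∸ i)))) (length-upTo (suc (j ∸ i)))

Vtotal≡triangle : ∀ i j → Vtotal i j ≡ triangle (suc (j ∸ i))
Vtotal≡triangle i j = begin
  length (concatMap intervalsFrom (valuesIn i j))
    ≡⟨ length-concatMap intervalsFrom (valuesIn i j) ⟩
  sum (map (length ∘ intervalsFrom) (map (_+_ i) (upTo (suc w))))
    ≡⟨ cong sum (map-∘ {g = length ∘ intervalsFrom} {f = _+_ i} (upTo (suc w))) ⟨
  sum (map (λ d → length (intervalsFrom (i + d))) (upTo (suc w)))
    ≡⟨ cong sum (map-cong intervalsFrom-count (upTo (suc w))) ⟩
  sum (map (λ d → suc (w ∸ d)) (upTo (suc w)))
    ≡⟨ cong sum (map-applyUpTo id (λ d → suc (w ∸ d)) (suc w)) ⟩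
  sum (applyUpTo (λ d → suc (w ∸ d)) (suc w))
    ≡⟨ sum-applyUpTo-suc∸ w ⟩
  triangle (suc w) ∎
  where
  w : ℕ
  w = j ∸ i
  intervalsFrom : ℕ → List (ℕ × ℕ)
  intervalsFrom k = map (λ l → (k , l)) (valuesIn k j)
  intervalsFrom-count : ∀ d → length (intervalsFrom (i + d)) ≡ suc (w ∸ d)
  intervalsFrom-count d = begin
    length (intervalsFrom (i + d))  ≡⟨ length-map _ (valuesIn (i + d) j) ⟩
    nVals (i + d) j                 ≡⟨ nVals≡ (i + d) j ⟩
    suc (j ∸ (i + d))               ≡⟨ cong suc (∸-+-assoc j i d) ⟨
    suc (w ∸ d)                     ∎

size-lecticTree-rightChange : ∀ i w → size (lecticTree rightChange i w) ≡ suc w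
size-lecticTree-rightChange i zero    = refl
size-lecticTree-rightChange i (suc w) =
  cong suc (trans (+-identityʳ _) (size-lecticTree-rightChange i w))

size-lecticTree-leftChange : ∀ i w → size (lecticTree leftChange i w) ≡ triangle (suc w)
size-lecticTree-leftChange i zero    = refl
size-lecticTree-leftChange i (suc w) = cong suc (begin
  size (lecticTree leftChange (suc i) w) + (size (lecticTree rightChange i w) + 0)
    ≡⟨ cong (_+_ (size (lecticTree leftChange (suc i) w))) (+-identityʳ _) ⟩
  size (lecticTree leftChange (suc i) w) + size (lecticTree rightChange i w)
    ≡⟨ cong₂ _+_ (size-lecticTree-leftChange (suc i) w) (size-lecticTree-rightChange i w) ⟩
  triangle (suc w) + suc w
    ≡⟨ +-comm (triangle (suc w)) (suc w) ⟩
  suc w + triangle (suc w) ∎)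

*≡*⇒/≡ : ∀ m a n b .{{_ : NonZero a}} .{{_ : NonZero b}} → m * b ≡ n * a → + m / a ≡ + n / b
*≡*⇒/≡ m (suc a) n (suc b) eq =
  fromℚᵘ-cong {mkℚᵘ (+ m) a} {mkℚᵘ (+ n) b}
    (*≡* (trans (sym (pos-* m (suc b))) (trans (cong +_ eq) (pos-* n (suc a)))))

n/n≡1 : ∀ n .{{_ : NonZero n}} → + n / n ≡ 1ℚ
n/n≡1 n = *≡*⇒/≡ n n 1 1 (*-comm n 1)

triangle/n≡[n+1]/2 : ∀ n .{{_ : NonZero n}} → + triangle n / n ≡ + suc n / 2
triangle/n≡[n+1]/2 n = *≡*⇒/≡ (triangle n) n (suc n) 2 (trans (triangle-*2 n) (*-comm n (suc n)))

proposition2 : (m i j : ℕ) → i ≤ j → j < m →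
    (ObtainedBy leftChange m i j → ρnorm leftChange i j ≡ 1ℚ)
    × (ObtainedBy rightChange m i j → ρnorm rightChange i j ≡ (+ suc (nVals i j)) / 2)
proposition2 _ i j _ _ = (λ _ → leftRate) , (λ _ → rightRate)
  where
  w : ℕ
  w = j ∸ i
  leftRate : ρnorm leftChange i j ≡ 1ℚ
  leftRate = begin
    ρnorm leftChange i j
      ≡⟨ /-cong ⦃ size-nonZero (lecticTree leftChange i w) ⦄
             (cong +_ (Vtotal≡triangle i j)) (size-lecticTree-leftChange i w) ⟩
    + triangle (suc w) / triangle (suc w)
      ≡⟨ n/n≡1 (triangle (suc w)) ⟩
    1ℚ ∎
  rightRate : ρnorm rightChange i j ≡ + suc (nVals i j) / 2
  rightRate = begin
    ρnorm rightChange i j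
      ≡⟨ /-cong ⦃ size-nonZero (lecticTree rightChange i w) ⦄
             (cong +_ (Vtotal≡triangle i j)) (size-lecticTree-rightChange i w) ⟩
    + triangle (suc w) / suc w
      ≡⟨ triangle/n≡[n+1]/2 (suc w) ⟩
    + suc (suc w) / 2
      ≡⟨ cong (λ n → + suc n / 2) (nVals≡ i j) ⟨
    + suc (nVals i j) / 2 ∎
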